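{- Let $M$ be a matroid on a finite set $E$ with a fixed linear order, and let $I=B\setminus Y$ be an independent set internally related to the basis $B$, with $Y\subseteq\operatorname{IA}(B)$. Then the facet $F(I)$ of $\Delta_M$ is obtained from $F(B)$ by replacing $z_Y$ with $y_Y$: $F(I)=(F(B)\setminus z_Y)\cup y_Y$.
   Context: Activities: for $S\subseteq E$, $e\in E\setminus S$ is externally active w.r.t. $S$ if there is a circuit $\gamma\subseteq S\cup\{e\}$ of $M$ with $e=\max\gamma$, externally passive otherwise; sets $\operatorname{EA}(S)$, $\operatorname{EP}(S)$. An element $i\in S$ is internally active w.r.t. $S$ if it is externally active w.r.t. $E\setminus S$ in the dual matroid $M^\perp$ (same order); set $\operatorname{IA}(S)$. Every independent set $I$ is uniquely $I=B\setminus Y$ with $B$ a basis and $Y\subseteq\operatorname{IA}(B)$. Augmented external activity complex $\Delta_M$: vertices $\{x_e,y_e,z_e:e\in E\}$, $x_S=\{x_e:e\in S\}$, $y_S$, $z_S$ similarly; facets $F(I)=x_{I\cup\operatorname{EP}(I)}y_Yz_{I\cup\operatorname{EA}(I)}$ (in particular for a basis $B$, $F(B)=x_{B\cup\operatorname{EP}(B)}z_{B\cup\operatorname{EA}(B)}$). -}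

module Defs where

open import Data.Nat using (ℕ; _<_)
open import Data.Fin using (Fin) renaming (_≤_ to _≤ᶠ_)
open import Data.Fin.Subset using (Subset; _∈_; _∉_; _⊆_; _∪_; _─_; ⁅_⁆; ∁; ∣_∣; ⊥)
open import Data.Product using (Σ; _×_; ∃)
open import Data.Sum using (_⊎_)
open import Data.Empty renaming (⊥ to Empty)
open import Relation.Nullary using (¬_)
open import Relation.Binary.PropositionalEquality using (_≡_)
open import Level using (0ℓ) renaming (suc to lsuc)

-- A matroid on the ground set E = Fin n, given by its independent sets.
-- The fixed linear order on E is the natural order of Fin n.
record Matroid (n : ℕ) : Set₁ where
  field
    Indep      : Subset n → Set
    indep-⊥    : Indep ⊥
    indep-↓    : ∀ {I J} → J ⊆ I → Indep I → Indep J
    indep-aug  : ∀ {I J} → Indep I → Indep J → ∣ I ∣ < ∣ J ∣ →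
                 ∃ λ e → e ∈ J × e ∉ I × Indep (I ∪ ⁅ e ⁆)

module _ {n : ℕ} where

  -- Notions relative to an arbitrary independence predicate (so that they
  -- can be applied to both M and its dual M^⊥).
  IsBasisOf : (Subset n → Set) → Subset n → Set
  IsBasisOf Ind B = Ind B × (∀ J → Ind J → B ⊆ J → J ≡ B)

  IsCircuitOf : (Subset n → Set) → Subset n → Set
  IsCircuitOf Ind C = ¬ Ind C × (∀ D → D ⊆ C → ¬ Ind D → D ≡ C)

  IsMaxOf : Fin n → Subset n → Set
  IsMaxOf e γ = e ∈ γ × (∀ f → f ∈ γ → f ≤ᶠ e)

  ExtActiveOf : (Subset n → Set) → Subset n → Fin n → Set
  ExtActiveOf Ind S e =
    e ∉ S × ∃ λ γ → IsCircuitOf Ind γ × γ ⊆ (S ∪ ⁅ e ⁆) × IsMaxOf e γ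

  ExtPassiveOf : (Subset n → Set) → Subset n → Fin n → Set
  ExtPassiveOf Ind S e =
    e ∉ S × ¬ (∃ λ γ → IsCircuitOf Ind γ × γ ⊆ (S ∪ ⁅ e ⁆) × IsMaxOf e γ)

  DualIndep : (Subset n → Set) → Subset n → Set
  DualIndep Ind S = ∃ λ B → IsBasisOf Ind B × S ⊆ ∁ B

module _ {n : ℕ} (M : Matroid n) where
  open Matroid M

  IsBasis : Subset n → Set
  IsBasis = IsBasisOf Indep

  EA : Subset n → Fin n → Set
  EA = ExtActiveOf Indep

  EP : Subset n → Fin n → Set
  EP = ExtPassiveOf Indep

  IA : Subset n → Fin n → Set
  IA S i = ExtActiveOf (DualIndep Indep) (∁ S) i

-- Vertices x_e, y_e, z_e of the augmented external activity complex.
data Tag : Set where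
  tx ty tz : Tag

data Vertex (n : ℕ) : Set where
  vtx : Tag → Fin n → Vertex n

Face : ℕ → Set₁
Face n = Vertex n → Set

module _ {n : ℕ} where
  xOf yOf zOf : (Fin n → Set) → Face n
  xOf S (vtx tx e) = S e
  xOf S (vtx ty e) = Empty
  xOf S (vtx tz e) = Empty
  yOf S (vtx tx e) = Empty
  yOf S (vtx ty e) = S e
  yOf S (vtx tz e) = Empty
  zOf S (vtx tx e) = Empty
  zOf S (vtx ty e) = Empty
  zOf S (vtx tz e) = S e

  _∪F_ : Face n → Face n → Face n
  (F ∪F G) v = F v ⊎ G v

  _∖F_ : Face n → Face n → Face n
  (F ∖F G) v = F v × ¬ G v

  _≈F_ : Face n → Face n → Set
  F ≈F G = ∀ v → (F v → G v) × (G v → F v)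

  mem : Subset n → Fin n → Set
  mem S e = e ∈ S

-- The facet F(I) = x_{I ∪ EP(I)} y_Y z_{I ∪ EA(I)}, where I = B \ Y is the
-- decomposition of the independent set I (Y is passed explicitly).
facet : ∀ {n} → Matroid n → (I Y : Subset n) → Face n
facet M I Y =
  (xOf (λ e → e ∈ I ⊎ EP M I e) ∪F yOf (mem Y)) ∪F zOf (λ e → e ∈ I ⊎ EA M I e)

-- An internally active element y of a basis B never lies on a circuit γ ⊆ B ∪ e
-- with maximum e: extending γ ∖ y inside B ∪ e gives a basis J avoiding y, and
-- any dual circuit C ⊆ (E ∖ B) ∪ y with maximum y misses J (its only candidate
-- common element e would satisfy e ≤ y ≤ e), so C would be dual independent.
-- Hence deleting Y ⊆ IA(B) from B keeps every circuit certifying external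
-- activity, and the activities of I = B ∖ Y differ from those of B only on Y,
-- whose elements become externally passive (a circuit in I ∪ y ⊆ B is impossible).
module Submission where

open import Defs
open import Data.Nat using (ℕ; suc; zero; _+_; _≤_; _<_; _≤?_; _<?_)
open import Data.Fin using (Fin)
open import Data.Fin.Subset using (Subset; _∈_; _─_; ⊥; _∉_; _⊆_; _∪_; ⁅_⁆; ∁; ∣_∣; _-_; inside; outside)
open import Data.Nat.Properties using (≤-trans; ≤-reflexive; +-suc; +-monoʳ-≤; m≤m+n; ≰⇒>; ≮⇒≥; <⇒≱)
open import Data.Fin.Properties using (≤-antisym; _≟_)
open import Data.Fin.Subset.Properties
open import Data.Product using (_×_; _,_; proj₁; proj₂; ∃; map₂)
open import Data.Sum using (_⊎_; inj₁; inj₂; [_,_]′)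
import Data.Sum as Sum
open import Data.Empty using (⊥-elim)
open import Data.Vec using (_∷_; here; there)
open import Function using (_∘_; id; _⇔_; mk⇔; Equivalence)
open import Relation.Nullary using (¬_; yes; no)
open import Relation.Binary.PropositionalEquality using (_≡_; refl; sym; subst)

private
  variable
    n : ℕ
    p q r : Subset n
    x : Fin n

x∈p─q⇒x∉q : ∀ (p q : Subset n) → x ∈ p ─ q → x ∉ q
x∈p─q⇒x∉q (inside ∷ p) (outside ∷ q) here ()
x∈p─q⇒x∉q (_ ∷ p) (_ ∷ q) (there x∈p─q) (there x∈q) = x∈p─q⇒x∉q p q x∈p─q x∈q

∪-monoˡ-⊆ : p ⊆ q → p ∪ r ⊆ q ∪ r
∪-monoˡ-⊆ {p = p} {r = r} p⊆q = x∈p∪q⁺ ∘ Sum.map₁ p⊆q ∘ x∈p∪q⁻ p r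

∪⁅x⁆⊆ : p ⊆ q → x ∈ q → p ∪ ⁅ x ⁆ ⊆ q
∪⁅x⁆⊆ {p = p} {x = x} p⊆q x∈q =
  [ p⊆q , (λ y∈⁅x⁆ → subst (_∈ _) (sym (x∈⁅y⁆⇒x≡y x y∈⁅x⁆)) x∈q) ]′ ∘ x∈p∪q⁻ p ⁅ x ⁆

x∉p⇒∣p∣<∣p∪⁅x⁆∣ : x ∉ p → ∣ p ∣ < ∣ p ∪ ⁅ x ⁆ ∣
x∉p⇒∣p∣<∣p∪⁅x⁆∣ {x = x} x∉p = p⊂q⇒∣p∣<∣q∣ (p⊆p∪q ⁅ x ⁆ , x , x∈p∪q⁺ (inj₂ (x∈⁅x⁆ x)) , x∉p)

p⊆q⇒∣q∣≤∣p∣⇒q≡p : p ⊆ q → ∣ q ∣ ≤ ∣ p ∣ → q ≡ p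
p⊆q⇒∣q∣≤∣p∣⇒q≡p {p = p} {q = q} p⊆q ∣q∣≤∣p∣ = ⊆-antisym q⊆p p⊆q
  where
  q⊆p : q ⊆ p
  q⊆p {x} x∈q with x ∈? p
  ... | yes x∈p = x∈p
  ... | no  x∉p = ⊥-elim (<⇒≱ (p⊂q⇒∣p∣<∣q∣ (p⊆q , x , x∈q , x∉p)) ∣q∣≤∣p∣)

module _ (M : Matroid n) where
  open Matroid M

  private
    variable
      B I J X γ : Subset n
      e y : Fin n

  ∣indep∣≤∣basis∣ : IsBasis M B → Indep J → ∣ J ∣ ≤ ∣ B ∣
  ∣indep∣≤∣basis∣ {B} {J} (B-indep , B-maximal) J-indep with ∣ B ∣ <? ∣ J ∣
  ... | no ∣B∣≮∣J∣ = ≮⇒≥ ∣B∣≮∣J∣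
  ... | yes ∣B∣<∣J∣ with indep-aug B-indep J-indep ∣B∣<∣J∣
  ... | f , _ , f∉B , B+f-indep =
    ⊥-elim (f∉B (subst (f ∈_) (B-maximal (B ∪ ⁅ f ⁆) B+f-indep (p⊆p∪q _))
                               (x∈p∪q⁺ (inj₂ (x∈⁅x⁆ f)))))

  indep-of-basis-size : IsBasis M B → Indep J → ∣ B ∣ ≤ ∣ J ∣ → IsBasis M J
  indep-of-basis-size B-basis J-indep ∣B∣≤∣J∣ =
    J-indep , λ K K-indep J⊆K →
      p⊆q⇒∣q∣≤∣p∣⇒q≡p J⊆K (≤-trans (∣indep∣≤∣basis∣ B-basis K-indep) ∣B∣≤∣J∣)

  -- Augmenting I from B one element at a time stays inside X since B ⊆ X; the
  -- fuel k bounds the number of steps.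
  extend-to-basis-within : IsBasis M B → B ⊆ X → Indep I → I ⊆ X →
                           ∃ λ J → IsBasis M J × I ⊆ J × J ⊆ X
  extend-to-basis-within {B} {X} {I} B-basis B⊆X I-indep I⊆X
    with go ∣ B ∣ I I-indep I⊆X (m≤m+n _ _)
    where
    go : ∀ k I → Indep I → I ⊆ X → ∣ B ∣ ≤ k + ∣ I ∣ →
         ∃ λ J → Indep J × ∣ B ∣ ≤ ∣ J ∣ × I ⊆ J × J ⊆ X
    go k I I-indep I⊆X ∣B∣≤k+∣I∣ with ∣ B ∣ ≤? ∣ I ∣
    ... | yes ∣B∣≤∣I∣ = I , I-indep , ∣B∣≤∣I∣ , id , I⊆X
    ... | no ∣B∣≰∣I∣ with indep-aug I-indep (proj₁ B-basis) (≰⇒> ∣B∣≰∣I∣) | k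
    ...   | _ | zero = ⊥-elim (∣B∣≰∣I∣ ∣B∣≤k+∣I∣)
    ...   | f , f∈B , f∉I , I+f-indep | suc k
          with go k (I ∪ ⁅ f ⁆) I+f-indep (∪⁅x⁆⊆ I⊆X (B⊆X f∈B))
                  (≤-trans ∣B∣≤k+∣I∣ (≤-trans (≤-reflexive (sym (+-suc k ∣ I ∣)))
                                               (+-monoʳ-≤ k (x∉p⇒∣p∣<∣p∪⁅x⁆∣ f∉I))))
    ...     | J , J-indep , ∣B∣≤∣J∣ , I+f⊆J , J⊆X =
                J , J-indep , ∣B∣≤∣J∣ , I+f⊆J ∘ p⊆p∪q ⁅ f ⁆ , J⊆X
  ... | J , J-indep , ∣B∣≤∣J∣ , I⊆J , J⊆X =
        J , indep-of-basis-size B-basis J-indep ∣B∣≤∣J∣ , I⊆J , J⊆X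

  -- Independence is not decidable, so minimality of γ only refutes the
  -- dependence of γ - y.
  circuit-minus-element : IsCircuitOf Indep γ → y ∈ γ → ¬ ¬ Indep (γ - y)
  circuit-minus-element {γ} {y} (_ , γ-minimal) y∈γ γ-y-dep =
    x∈p─q⇒x∉q γ ⁅ y ⁆ (subst (y ∈_) (sym (γ-minimal (γ - y) (p─q⊆p γ ⁅ y ⁆) γ-y-dep)) y∈γ)
              (x∈⁅x⁆ y)

  basis-avoiding-circuit-element : IsBasis M B → B ⊆ X → IsCircuitOf Indep γ → γ ⊆ X →
                                   Indep (γ - y) → ∃ λ J → IsBasis M J × J ⊆ X × y ∉ J
  basis-avoiding-circuit-element {γ = γ} {y = y} B-basis B⊆X (γ-dep , _) γ⊆X γ-y-indep
    with extend-to-basis-within B-basis B⊆X γ-y-indep (γ⊆X ∘ p─q⊆p γ ⁅ y ⁆)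
  ... | J , J-basis , γ-y⊆J , J⊆X =
        J , J-basis , J⊆X , λ y∈J → γ-dep (indep-↓ (γ⊆J y∈J) (proj₁ J-basis))
    where
    γ⊆J : y ∈ J → γ ⊆ J
    γ⊆J y∈J {x} x∈γ with x ≟ y
    ... | yes refl = y∈J
    ... | no  x≢y  = γ-y⊆J (x∈p∧x≢y⇒x∈p-y x∈γ x≢y)

  circuit-element-not-internally-active : IsBasis M B → IsCircuitOf Indep γ → γ ⊆ B ∪ ⁅ e ⁆ →
                                          IsMaxOf e γ → y ∈ γ → ¬ IA M B y
  circuit-element-not-internally-active {B} {γ} {e} {y} B-basis γ-circuit γ⊆B+e (_ , γ≤e) y∈γ
                                        (_ , C , (C-dep , _) , C⊆∁B+y , (_ , C≤y)) =
    circuit-minus-element γ-circuit y∈γ λ γ-y-indep →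
      let J , J-basis , J⊆B+e , y∉J =
            basis-avoiding-circuit-element B-basis (p⊆p∪q _) γ-circuit γ⊆B+e γ-y-indep
      in C-dep (J , J-basis , λ x∈C → x∉p⇒x∈∁p λ x∈J →
           y∉J (subst (_∈ J) (C∩[B∪e]⊆y x∈C (J⊆B+e x∈J)) x∈J))
    where
    C∩[B∪e]⊆y : x ∈ C → x ∈ B ∪ ⁅ e ⁆ → x ≡ y
    C∩[B∪e]⊆y {x} x∈C x∈B+e with x∈p∪q⁻ (∁ B) ⁅ y ⁆ (C⊆∁B+y x∈C) | x∈p∪q⁻ B ⁅ e ⁆ x∈B+e
    ... | inj₂ x∈⁅y⁆ | _         = x∈⁅y⁆⇒x≡y y x∈⁅y⁆
    ... | inj₁ x∈∁B  | inj₁ x∈B  = ⊥-elim (x∈∁p⇒x∉p x∈∁B x∈B)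
    ... | inj₁ _     | inj₂ x∈⁅e⁆ with x∈⁅y⁆⇒x≡y e x∈⁅e⁆
    ...   | refl = ≤-antisym (C≤y x x∈C) (γ≤e y y∈γ)

  -- EA M S e unfolds to e ∉ S × ∃ (ActiveCircuit S e), and EP M S e to its negated form.
  ActiveCircuit : Subset n → Fin n → Subset n → Set
  ActiveCircuit S e γ = IsCircuitOf Indep γ × γ ⊆ S ∪ ⁅ e ⁆ × IsMaxOf e γ

  activeCircuit-mono : p ⊆ q → ActiveCircuit p e γ → ActiveCircuit q e γ
  activeCircuit-mono p⊆q (γ-circuit , γ⊆p+e , e-max) = γ-circuit , ∪-monoˡ-⊆ p⊆q ∘ γ⊆p+e , e-max

  no-activeCircuit-in-indep : Indep I → e ∈ I → ¬ ActiveCircuit I e γ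
  no-activeCircuit-in-indep I-indep e∈I ((γ-dep , _) , γ⊆I+e , _) =
    γ-dep (indep-↓ (∪⁅x⁆⊆ id e∈I ∘ γ⊆I+e) I-indep)

  activeCircuit-avoids-internallyActive : ∀ {Y} → IsBasis M B → (∀ y → y ∈ Y → IA M B y) →
                                          ActiveCircuit B e γ → ActiveCircuit (B ─ Y) e γ
  activeCircuit-avoids-internallyActive {B} {e} {Y = Y} B-basis Y-active
                                        (γ-circuit , γ⊆B+e , e-max) =
    γ-circuit , γ⊆B-Y+e , e-max
    where
    γ⊆B-Y+e : _ ⊆ (B ─ Y) ∪ ⁅ e ⁆
    γ⊆B-Y+e {x} x∈γ with x∈p∪q⁻ B ⁅ e ⁆ (γ⊆B+e x∈γ)
    ... | inj₂ x∈⁅e⁆ = x∈p∪q⁺ (inj₂ x∈⁅e⁆)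
    ... | inj₁ x∈B with x ∈? Y
    ...   | yes x∈Y = ⊥-elim (circuit-element-not-internally-active
                                  B-basis γ-circuit γ⊆B+e e-max x∈γ (Y-active x x∈Y))
    ...   | no  x∉Y = x∈p∪q⁺ (inj₁ (x∈p∧x∉q⇒x∈p─q x∈B x∉Y))

xSupport zSupport : Matroid n → Subset n → Fin n → Set
xSupport M S e = e ∈ S ⊎ EP M S e
zSupport M S e = e ∈ S ⊎ EA M S e

module _ (M : Matroid n) {B Y : Subset n} (B-basis : IsBasis M B)
         (Y-active : ∀ y → y ∈ Y → IA M B y) where
  open Matroid M

  private
    B─Y⊆B : B ─ Y ⊆ B
    B─Y⊆B = p─q⊆p B Y

    Y⊆B : Y ⊆ B
    Y⊆B y∈Y = x∉∁p⇒x∈p (proj₁ (Y-active _ y∈Y))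

    avoid : ∀ {e γ} → ActiveCircuit M B e γ → ActiveCircuit M (B ─ Y) e γ
    avoid = activeCircuit-avoids-internallyActive M B-basis Y-active

    enlarge : ∀ {e γ} → ActiveCircuit M (B ─ Y) e γ → ActiveCircuit M B e γ
    enlarge = activeCircuit-mono M B─Y⊆B

    no-activeCircuit-in-B : ∀ {e γ} → e ∈ B → ¬ ActiveCircuit M B e γ
    no-activeCircuit-in-B = no-activeCircuit-in-indep M (proj₁ B-basis)

  xSupport-─internallyActive : ∀ e → xSupport M (B ─ Y) e ⇔ xSupport M B e
  xSupport-─internallyActive e = mk⇔ to from
    where
    to : xSupport M (B ─ Y) e → xSupport M B e
    to (inj₁ e∈B─Y) = inj₁ (B─Y⊆B e∈B─Y)
    to (inj₂ (_ , no-circuit)) with e ∈? B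
    ... | yes e∈B = inj₁ e∈B
    ... | no  e∉B = inj₂ (e∉B , no-circuit ∘ map₂ avoid)
    from : xSupport M B e → xSupport M (B ─ Y) e
    from (inj₁ e∈B) with e ∈? Y
    ... | yes e∈Y = inj₂ ((λ e∈B─Y → x∈p─q⇒x∉q B Y e∈B─Y e∈Y) ,
                          λ (_ , active) → no-activeCircuit-in-B e∈B (enlarge active))
    ... | no  e∉Y = inj₁ (x∈p∧x∉q⇒x∈p─q e∈B e∉Y)
    from (inj₂ (e∉B , no-circuit)) = inj₂ (e∉B ∘ B─Y⊆B , no-circuit ∘ map₂ enlarge)

  zSupport-─internallyActive : ∀ e → zSupport M (B ─ Y) e ⇔ (zSupport M B e × e ∉ Y)
  zSupport-─internallyActive e = mk⇔ to from
    where
    to : zSupport M (B ─ Y) e → zSupport M B e × e ∉ Y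
    to (inj₁ e∈B─Y) = inj₁ (B─Y⊆B e∈B─Y) , x∈p─q⇒x∉q B Y e∈B─Y
    to (inj₂ (_ , γ , active)) =
      inB-or-active , λ e∈Y → no-activeCircuit-in-B (Y⊆B e∈Y) (enlarge active)
      where
      inB-or-active : zSupport M B e
      inB-or-active with e ∈? B
      ... | yes e∈B = inj₁ e∈B
      ... | no  e∉B = inj₂ (e∉B , γ , enlarge active)
    from : zSupport M B e × e ∉ Y → zSupport M (B ─ Y) e
    from (inj₁ e∈B , e∉Y) = inj₁ (x∈p∧x∉q⇒x∈p─q e∈B e∉Y)
    from (inj₂ (e∉B , γ , active) , _) = inj₂ (e∉B ∘ B─Y⊆B , γ , avoid active)

-- facet M I Y is definitionally face (xSupport M I) (mem Y) (zSupport M I).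
face : (X Y Z : Fin n → Set) → Face n
face X Y Z = (xOf X ∪F yOf Y) ∪F zOf Z

≈F-trans : {F G H : Face n} → F ≈F G → G ≈F H → F ≈F H
≈F-trans F≈G G≈H v = proj₁ (G≈H v) ∘ proj₁ (F≈G v) , proj₂ (F≈G v) ∘ proj₂ (G≈H v)

face-cong : {X X′ Y Z Z′ : Fin n → Set} → (∀ e → X e ⇔ X′ e) → (∀ e → Z e ⇔ Z′ e) →
            face X Y Z ≈F face X′ Y Z′
face-cong X⇔X′ _ (vtx tx e) =
  Sum.map₁ (Sum.map₁ (Equivalence.to (X⇔X′ e))) ,
  Sum.map₁ (Sum.map₁ (Equivalence.from (X⇔X′ e)))
face-cong _ _ (vtx ty e) = id , id
face-cong _ Z⇔Z′ (vtx tz e) =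
  Sum.map₂ (Equivalence.to (Z⇔Z′ e)) , Sum.map₂ (Equivalence.from (Z⇔Z′ e))

face-swap-z-for-y : {X Z W : Fin n → Set} →
                    face X W (λ e → Z e × ¬ W e) ≈F ((face X (mem ⊥) Z ∖F zOf W) ∪F yOf W)
face-swap-z-for-y (vtx tx e) =
  (λ { (inj₁ (inj₁ x)) → inj₁ (inj₁ (inj₁ x) , λ ()) ; (inj₁ (inj₂ ())) ; (inj₂ ()) }) ,
  (λ { (inj₁ (inj₁ (inj₁ x) , _)) → inj₁ (inj₁ x) ; (inj₁ (inj₁ (inj₂ ()) , _))
     ; (inj₁ (inj₂ () , _)) ; (inj₂ ()) })
face-swap-z-for-y (vtx ty e) =
  (λ { (inj₁ (inj₁ ())) ; (inj₁ (inj₂ w)) → inj₂ w ; (inj₂ ()) }) ,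
  (λ { (inj₂ w) → inj₁ (inj₂ w) ; (inj₁ (inj₁ (inj₁ ()) , _))
     ; (inj₁ (inj₁ (inj₂ e∈⊥) , _)) → ⊥-elim (∉⊥ e∈⊥) ; (inj₁ (inj₂ () , _)) })
face-swap-z-for-y (vtx tz e) =
  (λ { (inj₁ (inj₁ ())) ; (inj₁ (inj₂ ())) ; (inj₂ (z , ¬w)) → inj₁ (inj₂ z , ¬w) }) ,
  (λ { (inj₁ (inj₁ (inj₁ ()) , _)) ; (inj₁ (inj₁ (inj₂ ()) , _))
     ; (inj₁ (inj₂ z , ¬w)) → inj₂ (z , ¬w) ; (inj₂ ()) })

corollary5p5 : ∀ {n : ℕ} (M : Matroid n) (B Y : Subset n) →
    IsBasis M B →
    (∀ e → e ∈ Y → IA M B e) →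
    facet M (B ─ Y) Y ≈F ((facet M B ⊥ ∖F zOf (mem Y)) ∪F yOf (mem Y))
corollary5p5 M B Y B-basis Y-active =
  ≈F-trans (face-cong (xSupport-─internallyActive M B-basis Y-active)
                      (zSupport-─internallyActive M B-basis Y-active))
           face-swap-z-for-y
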